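{- Let $p$ be a prime and let $H$ be a tree that has no automorphism of order $p$ and is not a star. Then $H$ has at least two vertices $\alpha,\beta$ with $\deg(\alpha)\not\equiv1\pmod p$ and $\deg(\beta)\not\equiv1\pmod p$.
   Context: A star is a complete bipartite graph $K_{1,n}$. An automorphism has order $p$ if $p$ is the least positive integer such that its $p$-fold composition is the identity. $\deg(v)$ is the degree of $v$. -}

module Defs where

open import Data.Nat using (ℕ; zero; suc; _%_; _≤_; NonZero)
open import Data.Nat.Primality using (Prime; prime⇒nonZero)
open import Data.Bool using (Bool; true; false; if_then_else_)
open import Data.Fin using (Fin)
open import Data.List using (List; []; _∷_; map; allFin; length)
open import Data.Nat.ListAction using (sum)
open import Data.List.Relation.Unary.Unique.Propositional using (Unique)
open import Data.Product using (Σ; ∃; _×_; _,_)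
open import Data.Sum using (_⊎_)
open import Relation.Binary.PropositionalEquality using (_≡_; _≢_)
open import Relation.Nullary using (¬_)
open import Function.Definitions using (Bijective)
open import Function.Bundles using (_⇔_)

record Graph (n : ℕ) : Set where
  field
    adj       : Fin n → Fin n → Bool
    adj-sym   : ∀ u v → adj u v ≡ adj v u
    adj-irrefl : ∀ u → adj u u ≡ false

open Graph public

module _ {n : ℕ} (G : Graph n) where

  Adj : Fin n → Fin n → Set
  Adj u v = adj G u v ≡ true

  deg : Fin n → ℕ
  deg u = sum (map (λ v → if adj G u v then 1 else 0) (allFin n))

  data Walk : Fin n → Fin n → List (Fin n) → Set where
    [_]  : ∀ u → Walk u u (u ∷ [])
    _∷ʷ_ : ∀ {u w v xs} → Adj u w → Walk w v xs → Walk u v (u ∷ xs)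

  Connected : Set
  Connected = ∀ u v → ∃ λ xs → Walk u v xs

  -- a cycle: distinct vertices x₀ … xₖ (k ≥ 2, i.e. at least 3 vertices),
  -- consecutive ones adjacent, and xₖ adjacent to x₀
  HasCycle : Set
  HasCycle = Σ (Fin n) λ u → Σ (Fin n) λ v → Σ (List (Fin n)) λ xs →
    Walk u v xs × Unique xs × (3 ≤ length xs) × Adj v u

  IsTree : Set
  IsTree = (1 ≤ n) × Connected × ¬ HasCycle

  IsStar : Set
  IsStar = Σ (Fin n) λ c → ∀ u v → Adj u v ⇔ ((u ≡ c ⊎ v ≡ c) × u ≢ v)

  IsAutomorphism : (Fin n → Fin n) → Set
  IsAutomorphism σ = Bijective _≡_ _≡_ σ × (∀ u v → adj G (σ u) (σ v) ≡ adj G u v)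

iter : ∀ {n} → ℕ → (Fin n → Fin n) → Fin n → Fin n
iter zero    σ x = x
iter (suc k) σ x = σ (iter k σ x)

IsIdentity : ∀ {n} → (Fin n → Fin n) → Set
IsIdentity f = ∀ x → f x ≡ x

HasOrder : ∀ {n} → (Fin n → Fin n) → ℕ → Set
HasOrder σ p = (1 ≤ p) × IsIdentity (iter p σ) × (∀ k → 1 ≤ k → k Data.Nat.< p → ¬ IsIdentity (iter k σ))

NotOneMod : (d p : ℕ) → Prime p → Set
NotOneMod d p pp = let instance _ = prime⇒nonZero pp in ¬ (d % p ≡ 1 % p)

-- Suppose every vertex except possibly r has degree ≡ 1 (mod p). If all neighbours of r
-- are leaves, the tree is a star centred at r. Otherwise walk away from r through vertices
-- of degree ≥ 2 until every further neighbour is a leaf; the vertex v ≠ r reached has degree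
-- ≡ 1 (mod p) and ≥ 2, hence at least p + 1, so it carries at least p leaves. Leaves on a
-- common vertex have identical adjacency, so cycling p of them is an automorphism of order p.
module Submission where

open import Defs
open import Data.Nat using (ℕ)
open import Data.Nat.Primality using (Prime)
open import Data.Fin using (Fin)
open import Data.Product using (Σ; _×_)
open import Relation.Binary.PropositionalEquality using (_≢_)
open import Relation.Nullary using (¬_)

open import Data.Nat using (zero; suc; _+_; _≤_; _<_; _%_; NonZero; z≤n; s≤s; _≤?_; nonTrivial⇒n>1; >-nonZero⁻¹) renaming (_≟_ to _≟ℕ_)
open import Data.Nat.Properties
  using (+-identityʳ; +-suc; ≤-refl; ≤-trans; ≤-reflexive; <-≤-trans; <-irrefl; <⇒≱; ≤-pred; ≰⇒>; m≤n⇒m<n∨m≡n; n<1+n; m<n⇒m<1+n)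
open import Data.Nat.DivMod using (%-distribˡ-+; m%n%n≡m%n; m<n⇒m%n≡m; m%n<n; [m+n]%n≡m%n; n%n≡0)
open import Data.Nat.Primality using (prime⇒nonZero; prime⇒nonTrivial)
open import Data.Fin as Fin using (toℕ; fromℕ<)
open import Data.Fin.Properties using (toℕ<n; toℕ-fromℕ<; toℕ-injective; pigeonhole; <⇒≢; any?; _≟_)
open import Data.Bool using (true; if_then_else_)
open import Data.Bool.Properties using (¬-not; ⇔→≡) renaming (_≟_ to _≟ᵇ_)
open import Data.List using (List; []; _∷_; length; filter; allFin; map)
open import Data.Nat.ListAction using (sum)
open import Data.List.Properties using (filter-all)
open import Data.List.Membership.Propositional using (_∈_; _∉_; find)
open import Data.List.Membership.Propositional.Properties using (∈-filter⁺; ∈-filter⁻; ∈-allFin)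
open import Data.List.Relation.Binary.Subset.Propositional using (_⊆_)
open import Data.List.Relation.Unary.Any as Any using (here; there)
open import Data.List.Relation.Unary.All as All using (All; []; _∷_)
open import Data.List.Relation.Unary.AllPairs using ([]; _∷_)
open import Data.List.Relation.Unary.Unique.Propositional using (Unique)
open import Data.List.Relation.Unary.Unique.Propositional.Properties using (filter⁺; allFin⁺)
open import Data.Product using (∃; _,_; proj₁; proj₂)
open import Data.Sum using (_⊎_; inj₁; inj₂; fromInj₁)
open import Data.Empty using (⊥; ⊥-elim)
open import Relation.Nullary using (yes; no; ¬?; _×-dec_; decidable-stable; contradiction)
open import Relation.Unary using (Pred; Decidable)
open import Relation.Binary.Definitions using (DecidableEquality)
open import Relation.Binary.PropositionalEquality using (_≡_; refl; sym; trans; cong; subst; module ≡-Reasoning)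
open import Function.Definitions using (Bijective)
open import Function.Bundles using (_⇔_; mk⇔)
import Function.Properties.Equivalence as ⇔

[1+m%n]%n≡[1+m]%n : ∀ m n .{{_ : NonZero n}} → suc (m % n) % n ≡ suc m % n
[1+m%n]%n≡[1+m]%n m n = begin
  (1 + m % n) % n           ≡⟨ %-distribˡ-+ 1 (m % n) n ⟩
  (1 % n + m % n % n) % n   ≡⟨ cong (λ t → (1 % n + t) % n) (m%n%n≡m%n m n) ⟩
  (1 % n + m % n) % n       ≡⟨ %-distribˡ-+ 1 m n ⟨
  (1 + m) % n               ∎
  where open ≡-Reasoning

m%n≡1%n⇒n<m : ∀ {m n} .{{_ : NonZero n}} → 1 < n → 2 ≤ m → m % n ≡ 1 % n → n < m
m%n≡1%n⇒n<m {m} {n} 1<n 2≤m m≡1 with suc n ≤? m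
... | yes n<m = n<m
... | no n≮m with m≤n⇒m<n∨m≡n (≤-pred (≰⇒> n≮m))
...   | inj₁ m<n = contradiction (trans (sym (m<n⇒m%n≡m m<n)) (trans m≡1 (m<n⇒m%n≡m 1<n))) λ { refl → <-irrefl refl 2≤m }
...   | inj₂ refl with trans (sym (n%n≡0 m)) (trans m≡1 (m<n⇒m%n≡m 1<n))
...     | ()

two-counterexamples⊎all-but-one : ∀ {a n} {P : Pred (Fin n) a} → Decidable P → 1 ≤ n →
  (Σ (Fin n) λ α → Σ (Fin n) λ β → α ≢ β × ¬ P α × ¬ P β) ⊎ (Σ (Fin n) λ r → ∀ x → x ≢ r → P x)
two-counterexamples⊎all-but-one {n = suc _} P? _ with any? (λ x → ¬? (P? x))
... | no none = inj₂ (Fin.zero , λ x _ → decidable-stable (P? x) λ ¬Px → none (x , ¬Px))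
... | yes (α , ¬Pα) with any? (λ x → ¬? (x ≟ α) ×-dec ¬? (P? x))
...   | yes (β , β≢α , ¬Pβ) = inj₁ (α , β , (λ α≡β → β≢α (sym α≡β)) , ¬Pα , ¬Pβ)
...   | no none = inj₂ (α , λ x x≢α → decidable-stable (P? x) λ ¬Px → none (x , x≢α , ¬Px))

nth : ∀ {a} {A : Set a} → List A → A → ℕ → A
nth []       d i       = d
nth (x ∷ xs) d zero    = x
nth (x ∷ xs) d (suc i) = nth xs d i

nth-∈ : ∀ {a} {A : Set a} (xs : List A) d {i} → i < length xs → nth xs d i ∈ xs
nth-∈ (x ∷ xs) d {zero}  _         = here refl
nth-∈ (x ∷ xs) d {suc i} (s≤s i<) = there (nth-∈ xs d i<)

nth-injective : ∀ {a} {A : Set a} {xs : List A} d → Unique xs → ∀ {i j} →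
  i < length xs → j < length xs → nth xs d i ≡ nth xs d j → i ≡ j
nth-injective {xs = x ∷ xs} d _           {zero}  {zero}  _        _        _ = refl
nth-injective {xs = x ∷ xs} d (x∉ ∷ _)    {zero}  {suc j} _        (s≤s j<) e = contradiction e (All.lookup x∉ (nth-∈ xs d j<))
nth-injective {xs = x ∷ xs} d (x∉ ∷ _)    {suc i} {zero}  (s≤s i<) _        e = contradiction (sym e) (All.lookup x∉ (nth-∈ xs d i<))
nth-injective {xs = x ∷ xs} d (_ ∷ uniq)  {suc i} {suc j} (s≤s i<) (s≤s j<) e = cong suc (nth-injective d uniq i< j< e)

unique⇒length≤ : ∀ {n} {xs : List (Fin n)} → Unique xs → length xs ≤ n
unique⇒length≤ {n} {[]}         _    = z≤n
unique⇒length≤ {n} {xs@(x ∷ _)} uniq with length xs ≤? n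
... | yes ≤n = ≤n
... | no >n with pigeonhole (≰⇒> >n) (λ i → nth xs x (toℕ i))
...   | i , j , i<j , e = contradiction (toℕ-injective (nth-injective x uniq (toℕ<n i) (toℕ<n j) e)) (<⇒≢ i<j)

module _ {a} {A : Set a} (_≟ᴬ_ : DecidableEquality A) where

  length≤1+length-without : ∀ {y} {xs : List A} → Unique xs → y ∈ xs →
    length xs ≤ suc (length (filter (λ x → ¬? (x ≟ᴬ y)) xs))
  length≤1+length-without {y} {x ∷ xs} (x∉ ∷ uniq) y∈ with x ≟ᴬ y | y∈
  ... | yes refl | _ rewrite filter-all (λ x → ¬? (x ≟ᴬ y)) (All.map (λ x≢y y≡x → x≢y (sym y≡x)) x∉) = ≤-refl
  ... | no x≢y   | here y≡x = contradiction (sym y≡x) x≢y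
  ... | no _     | there y∈xs = s≤s (length≤1+length-without uniq y∈xs)

two-distinct-∈⇒2≤length : ∀ {a} {A : Set a} {x y : A} {xs} → x ∈ xs → y ∈ xs → x ≢ y → 2 ≤ length xs
two-distinct-∈⇒2≤length {xs = _ ∷ _ ∷ _} _          _          _   = s≤s (s≤s z≤n)
two-distinct-∈⇒2≤length {xs = _ ∷ []}    (here refl) (here refl) x≢y = contradiction refl x≢y

iter-suc : ∀ {n} k (σ : Fin n → Fin n) x → iter (suc k) σ x ≡ iter k σ (σ x)
iter-suc zero    σ x = refl
iter-suc (suc k) σ x = cong σ (iter-suc k σ x)

periodic⇒bijective : ∀ {n k} (σ : Fin n → Fin n) → 1 ≤ k → IsIdentity (iter k σ) → Bijective _≡_ _≡_ σ
periodic⇒bijective {n} {suc q} σ _ σᵏ≡id = injective , surjective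
  where
  σ⁻¹ : Fin n → Fin n
  σ⁻¹ = iter q σ
  σ⁻¹∘σ : ∀ x → σ⁻¹ (σ x) ≡ x
  σ⁻¹∘σ x = trans (sym (iter-suc q σ x)) (σᵏ≡id x)
  injective : ∀ {a b} → σ a ≡ σ b → a ≡ b
  injective {a} {b} σa≡σb = trans (sym (σ⁻¹∘σ a)) (trans (cong σ⁻¹ σa≡σb) (σ⁻¹∘σ b))
  surjective : ∀ y → ∃ λ x → ∀ {z} → z ≡ x → σ z ≡ y
  surjective y = σ⁻¹ y , λ { refl → σᵏ≡id y }

twin-preserving⇒automorphism : ∀ {n} (G : Graph n) (σ : Fin n → Fin n) → Bijective _≡_ _≡_ σ →
  (∀ x y → adj G (σ x) y ≡ adj G x y) → IsAutomorphism G σ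
twin-preserving⇒automorphism G σ bij twin = bij , λ u w → begin
  adj G (σ u) (σ w) ≡⟨ twin u (σ w) ⟩
  adj G u (σ w)     ≡⟨ adj-sym G u (σ w) ⟩
  adj G (σ w) u     ≡⟨ twin w u ⟩
  adj G w u         ≡⟨ adj-sym G w u ⟩
  adj G u w         ∎
  where open ≡-Reasoning

module Rotation {n : ℕ} (p : ℕ) .{{_ : NonZero p}} (f : ℕ → Fin n)
  (f-injective : ∀ {i j} → i < p → j < p → f i ≡ f j → i ≡ j) where

  OnCycle : Fin n → Set
  OnCycle x = Σ ℕ λ j → j < p × f j ≡ x

  onCycle? : ∀ x → OnCycle x ⊎ (∀ j → j < p → f j ≢ x)
  onCycle? x with any? (λ (i : Fin p) → f (toℕ i) ≟ x)
  ... | yes (i , fi≡x) = inj₁ (toℕ i , toℕ<n i , fi≡x)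
  ... | no none = inj₂ λ j j<p fj≡x → none (fromℕ< j<p , trans (cong f (toℕ-fromℕ< j<p)) fj≡x)

  rotate : Fin n → Fin n
  rotate x with onCycle? x
  ... | inj₁ (j , _) = f (suc j % p)
  ... | inj₂ _ = x

  rotate-on : ∀ {j} → j < p → rotate (f j) ≡ f (suc j % p)
  rotate-on {j} j<p with onCycle? (f j)
  ... | inj₁ (i , i<p , fi≡fj) = cong (λ t → f (suc t % p)) (f-injective i<p j<p fi≡fj)
  ... | inj₂ off = contradiction refl (off j j<p)

  rotate-off : ∀ {x} → (∀ j → j < p → f j ≢ x) → rotate x ≡ x
  rotate-off {x} off with onCycle? x
  ... | inj₁ (i , i<p , fi≡x) = contradiction fi≡x (off i i<p)
  ... | inj₂ _ = refl

  iter-rotate-on : ∀ {i} k → i < p → iter k rotate (f i) ≡ f ((i + k) % p)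
  iter-rotate-on {i} zero i<p = cong f (sym (trans (cong (_% p) (+-identityʳ i)) (m<n⇒m%n≡m i<p)))
  iter-rotate-on {i} (suc k) i<p = begin
    rotate (iter k rotate (f i)) ≡⟨ cong rotate (iter-rotate-on k i<p) ⟩
    rotate (f ((i + k) % p))     ≡⟨ rotate-on (m%n<n (i + k) p) ⟩
    f (suc ((i + k) % p) % p)    ≡⟨ cong f ([1+m%n]%n≡[1+m]%n (i + k) p) ⟩
    f (suc (i + k) % p)          ≡⟨ cong (λ t → f (t % p)) (+-suc i k) ⟨
    f ((i + suc k) % p)          ∎
    where open ≡-Reasoning

  iter-rotate-off : ∀ {x} k → (∀ j → j < p → f j ≢ x) → iter k rotate x ≡ x
  iter-rotate-off zero    off = refl
  iter-rotate-off (suc k) off = trans (cong rotate (iter-rotate-off k off)) (rotate-off off)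

  rotateᵖ≡id : IsIdentity (iter p rotate)
  rotateᵖ≡id x with onCycle? x
  ... | inj₁ (j , j<p , refl) =
    trans (iter-rotate-on p j<p) (cong f (trans ([m+n]%n≡m%n j p) (m<n⇒m%n≡m j<p)))
  ... | inj₂ off = iter-rotate-off p off

  rotate-hasOrder : HasOrder rotate p
  rotate-hasOrder = 0<p , rotateᵖ≡id , λ k 1≤k k<p rotateᵏ≡id →
    <-irrefl (sym (f-injective k<p 0<p (fₖ≡f₀ k<p rotateᵏ≡id))) 1≤k
    where
    0<p : 0 < p
    0<p = >-nonZero⁻¹ p
    fₖ≡f₀ : ∀ {k} → k < p → IsIdentity (iter k rotate) → f k ≡ f 0
    fₖ≡f₀ {k} k<p rotateᵏ≡id =
      trans (cong f (sym (m<n⇒m%n≡m k<p))) (trans (sym (iter-rotate-on k 0<p)) (rotateᵏ≡id (f 0)))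

  rotate-twin : (G : Graph n) → (∀ {i j} → i < p → j < p → ∀ y → adj G (f i) y ≡ adj G (f j) y) →
    ∀ x y → adj G (rotate x) y ≡ adj G x y
  rotate-twin G twins x y with onCycle? x
  ... | inj₁ (j , j<p , refl) = twins (m%n<n (suc j) p) j<p y
  ... | inj₂ _ = refl

twins⇒automorphismOfOrder : ∀ {n} (G : Graph n) (p : ℕ) .{{_ : NonZero p}} (f : ℕ → Fin n) →
  (∀ {i j} → i < p → j < p → f i ≡ f j → i ≡ j) →
  (∀ {i j} → i < p → j < p → ∀ y → adj G (f i) y ≡ adj G (f j) y) →
  Σ (Fin n → Fin n) λ σ → IsAutomorphism G σ × HasOrder σ p
twins⇒automorphismOfOrder G p f f-injective twins =
  rotate , twin-preserving⇒automorphism G rotate bijective (rotate-twin G twins) , rotate-hasOrder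
  where
  open Rotation p f f-injective
  bijective : Bijective _≡_ _≡_ rotate
  bijective = periodic⇒bijective rotate (proj₁ rotate-hasOrder) rotateᵖ≡id

module _ {n : ℕ} (H : Graph n) where

  Adj-sym : ∀ {u w} → Adj H u w → Adj H w u
  Adj-sym {u} {w} uw = trans (adj-sym H w u) uw

  Adj-irrefl : ∀ {u} → ¬ Adj H u u
  Adj-irrefl {u} uu with trans (sym (adj-irrefl H u)) uu
  ... | ()

  neighbours : Fin n → List (Fin n)
  neighbours u = filter (λ w → adj H u w ≟ᵇ true) (allFin n)

  neighbours-unique : ∀ u → Unique (neighbours u)
  neighbours-unique u = filter⁺ (λ w → adj H u w ≟ᵇ true) (allFin⁺ n)

  ∈-neighbours⁺ : ∀ {u w} → Adj H u w → w ∈ neighbours u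
  ∈-neighbours⁺ {u} {w} = ∈-filter⁺ (λ w → adj H u w ≟ᵇ true) (∈-allFin w)

  ∈-neighbours⁻ : ∀ {u w} → w ∈ neighbours u → Adj H u w
  ∈-neighbours⁻ {u} w∈ = proj₂ (∈-filter⁻ (λ w → adj H u w ≟ᵇ true) {xs = allFin n} w∈)

  deg≡length-neighbours : ∀ u → deg H u ≡ length (neighbours u)
  deg≡length-neighbours u = count (allFin n)
    where
    count : ∀ xs → sum (map (λ w → if adj H u w then 1 else 0) xs) ≡ length (filter (λ w → adj H u w ≟ᵇ true) xs)
    count [] = refl
    count (x ∷ xs) with adj H u x ≟ᵇ true
    ... | yes uw rewrite uw = cong suc (count xs)
    ... | no ¬uw rewrite ¬-not ¬uw = count xs

  Internal : Fin n → Set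
  Internal w = 2 ≤ deg H w

  Internal? : Decidable Internal
  Internal? w = 2 ≤? deg H w

  ¬internal⇒neighbour-unique : ∀ {w a b} → ¬ Internal w → Adj H w a → Adj H w b → a ≡ b
  ¬internal⇒neighbour-unique {w} {a} {b} ¬int wa wb with a ≟ b
  ... | yes a≡b = a≡b
  ... | no a≢b = contradiction
    (subst (2 ≤_) (sym (deg≡length-neighbours w)) (two-distinct-∈⇒2≤length (∈-neighbours⁺ wa) (∈-neighbours⁺ wb) a≢b))
    ¬int

  ¬internal⇒Adj⇔ : ∀ {w v} → ¬ Internal w → Adj H w v → ∀ y → Adj H w y ⇔ y ≡ v
  ¬internal⇒Adj⇔ ¬int wv y = mk⇔ (λ wy → ¬internal⇒neighbour-unique ¬int wy wv) (λ { refl → wv })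

  pendants-twins : ∀ {v w w′} → ¬ Internal w → ¬ Internal w′ → Adj H v w → Adj H v w′ →
    ∀ y → adj H w y ≡ adj H w′ y
  pendants-twins ¬int ¬int′ vw vw′ y =
    ⇔→≡ (⇔.trans (¬internal⇒Adj⇔ ¬int (Adj-sym vw) y) (⇔.sym (¬internal⇒Adj⇔ ¬int′ (Adj-sym vw′) y)))

  pendant-fan⇒automorphismOfOrder : ∀ p .{{_ : NonZero p}} {v} {L : List (Fin n)} → Unique L → p ≤ length L →
    (∀ {w} → w ∈ L → Adj H v w × ¬ Internal w) →
    Σ (Fin n → Fin n) λ σ → IsAutomorphism H σ × HasOrder σ p
  pendant-fan⇒automorphismOfOrder p {v} {L} uniq p≤ pendant =
    twins⇒automorphismOfOrder H p (nth L v)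
      (λ i<p j<p → nth-injective v uniq (<-≤-trans i<p p≤) (<-≤-trans j<p p≤))
      (λ i<p j<p → pendants-twins (proj₂ (pendantᵢ i<p)) (proj₂ (pendantᵢ j<p)) (proj₁ (pendantᵢ i<p)) (proj₁ (pendantᵢ j<p)))
    where
    pendantᵢ : ∀ {i} → i < p → Adj H v (nth L v i) × ¬ Internal (nth L v i)
    pendantᵢ i<p = pendant (nth-∈ L v (<-≤-trans i<p p≤))

  pendant-neighbours⇒star : Connected H → ∀ r → (∀ {w} → Adj H r w → ¬ Internal w) → IsStar H
  pendant-neighbours⇒star connected r pendant = r , λ u w → mk⇔ (to u w) (from u w)
    where
    Near : Fin n → Set
    Near x = x ≡ r ⊎ Adj H r x
    walk-near : ∀ {a b xs} → Walk H a b xs → Near a → Near b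
    walk-near [ _ ]    near             = near
    walk-near (e ∷ʷ W) (inj₁ refl)      = walk-near W (inj₂ e)
    walk-near (e ∷ʷ W) (inj₂ ra)        = walk-near W (inj₁ (¬internal⇒neighbour-unique (pendant ra) e (Adj-sym ra)))
    near : ∀ u → Near u
    near u = walk-near (proj₂ (connected r u)) (inj₁ refl)
    to : ∀ u w → Adj H u w → (u ≡ r ⊎ w ≡ r) × u ≢ w
    to u w uw with near u
    ... | inj₁ u≡r = inj₁ u≡r , λ { refl → Adj-irrefl uw }
    ... | inj₂ ru  = inj₂ (¬internal⇒neighbour-unique (pendant ru) uw (Adj-sym ru)) , λ { refl → Adj-irrefl uw }
    from : ∀ u w → (u ≡ r ⊎ w ≡ r) × u ≢ w → Adj H u w
    from u w (inj₁ refl , u≢w) with near w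
    ... | inj₁ w≡r = contradiction (sym w≡r) u≢w
    ... | inj₂ rw  = rw
    from u w (inj₂ refl , u≢w) with near u
    ... | inj₁ u≡r = contradiction u≡r u≢w
    ... | inj₂ ru  = Adj-sym ru

  children : Fin n → Fin n → List (Fin n)
  children v par = filter (λ w → ¬? (w ≟ par)) (neighbours v)

  children-unique : ∀ v par → Unique (children v par)
  children-unique v par = filter⁺ (λ w → ¬? (w ≟ par)) (neighbours-unique v)

  ∈-children⁻ : ∀ {v par w} → w ∈ children v par → Adj H v w × w ≢ par
  ∈-children⁻ {v} {par} w∈ with ∈-filter⁻ (λ w → ¬? (w ≟ par)) {xs = neighbours v} w∈
  ... | w∈nbrs , w≢par = ∈-neighbours⁻ w∈nbrs , w≢par

  deg≤1+length-children : ∀ {v par} → Adj H v par → deg H v ≤ suc (length (children v par))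
  deg≤1+length-children {v} vpar = ≤-trans (≤-reflexive (deg≡length-neighbours v))
    (length≤1+length-without _≟_ (neighbours-unique v) (∈-neighbours⁺ vpar))

  walk-end-∈ : ∀ {a b xs} → Walk H a b xs → b ∈ xs
  walk-end-∈ [ _ ]    = here refl
  walk-end-∈ (_ ∷ʷ W) = there (walk-end-∈ W)

  walk-distinct-ends⇒2≤length : ∀ {a b xs} → Walk H a b xs → a ≢ b → 2 ≤ length xs
  walk-distinct-ends⇒2≤length [ _ ]             a≢a = contradiction refl a≢a
  walk-distinct-ends⇒2≤length (_ ∷ʷ [ _ ])      _   = s≤s (s≤s z≤n)
  walk-distinct-ends⇒2≤length (_ ∷ʷ (_ ∷ʷ _))   _   = s≤s (s≤s z≤n)

  walk-prefix : ∀ {a b xs y} → Walk H a b xs → Unique xs → y ∈ xs →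
    Σ (List (Fin n)) λ ys → Walk H a y ys × Unique ys × ys ⊆ xs
  walk-prefix [ a ]              _ (here refl) = a ∷ [] , [ a ] , [] ∷ [] , λ z∈ → z∈
  walk-prefix (_∷ʷ_ {a} _ _)     _ (here refl) = a ∷ [] , [ a ] , [] ∷ [] , λ { (here refl) → here refl }
  walk-prefix (_∷ʷ_ {a} e W) (a∉ ∷ uniq) (there y∈) with walk-prefix W uniq y∈
  ... | ys , W′ , uniq′ , ys⊆ = a ∷ ys , e ∷ʷ W′ , All.tabulate (λ z∈ → All.lookup a∉ (ys⊆ z∈)) ∷ uniq′ ,
    λ { (here refl) → here refl ; (there z∈) → there (ys⊆ z∈) }

  -- A deepest internal vertex of the tree rooted at r.
  record Fringe (r : Fin n) : Set where
    field
      vertex parent    : Fin n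
      vertex≢r         : vertex ≢ r
      vertex-parent    : Adj H vertex parent
      internal         : Internal vertex
      pendant-children : ∀ {w} → w ∈ children vertex parent → ¬ Internal w

  fringe⇒automorphismOfOrder : ∀ p .{{_ : NonZero p}} {r} (F : Fringe r) → p < deg H (Fringe.vertex F) →
    Σ (Fin n → Fin n) λ σ → IsAutomorphism H σ × HasOrder σ p
  fringe⇒automorphismOfOrder p F p<deg = pendant-fan⇒automorphismOfOrder p (children-unique vertex parent)
    (≤-pred (≤-trans p<deg (deg≤1+length-children vertex-parent)))
    (λ w∈ → proj₁ (∈-children⁻ w∈) , pendant-children w∈)
    where open Fringe F

  module _ (acyclic : ¬ HasCycle H) where

    neighbour-off-path : ∀ {v par b xs w} → Adj H v par → Walk H par b xs → Unique (v ∷ xs) →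
      Adj H v w → w ≢ par → w ∉ xs
    neighbour-off-path vpar W (v∉ ∷ uniq) vw w≢par w∈ with walk-prefix W uniq w∈
    ... | ys , W′ , uniq′ , ys⊆ = acyclic (_ , _ , _ ∷ ys , vpar ∷ʷ W′ ,
      All.tabulate (λ z∈ → All.lookup v∉ (ys⊆ z∈)) ∷ uniq′ ,
      s≤s (walk-distinct-ends⇒2≤length W′ λ par≡w → w≢par (sym par≡w)) , Adj-sym vw)

    -- Acyclicity keeps the path v, par, …, r simple, so its length is at most n and k is fuel.
    descend : ∀ {r} k {v par xs} → n < length (v ∷ xs) + k →
      Adj H v par → Walk H par r xs → Unique (v ∷ xs) → Internal v → Fringe r
    descend zero n< _ _ uniq _ = contradiction (unique⇒length≤ uniq) (<⇒≱ (subst (n <_) (+-identityʳ _) n<))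
    descend (suc k) {v} {par} {xs} n< vpar W uniq@(v∉ ∷ _) int with Any.any? Internal? (children v par)
    ... | no none = record
      { vertex = v ; parent = par ; vertex≢r = All.lookup v∉ (walk-end-∈ W) ; vertex-parent = vpar
      ; internal = int ; pendant-children = λ w∈ int-w → none (Any.map (λ { refl → int-w }) w∈) }
    ... | yes some with find some
    ...   | w , w∈ , int-w = descend k (subst (n <_) (+-suc _ k) n<) (Adj-sym vw) (vpar ∷ʷ W) (w∉ ∷ uniq) int-w
      where
      vw : Adj H v w
      vw = proj₁ (∈-children⁻ w∈)
      w∉ : All (w ≢_) (v ∷ xs)
      w∉ = (λ { refl → Adj-irrefl vw }) ∷
           All.tabulate (λ { z∈ refl → neighbour-off-path vpar W uniq vw (proj₂ (∈-children⁻ w∈)) z∈ })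

    fringe⊎star : Connected H → ∀ r → Fringe r ⊎ IsStar H
    fringe⊎star connected r with Any.any? Internal? (neighbours r)
    ... | no none = inj₂ (pendant-neighbours⇒star connected r λ rw int → none (Any.map (λ { refl → int }) (∈-neighbours⁺ rw)))
    ... | yes some with find some
    ...   | w , w∈ , int = inj₁ (descend n (m<n⇒m<1+n (n<1+n n)) (Adj-sym rw) [ r ] ((w≢r ∷ []) ∷ [] ∷ []) int)
      where
      rw : Adj H r w
      rw = ∈-neighbours⁻ w∈
      w≢r : w ≢ r
      w≢r refl = Adj-irrefl rw

lemma7 : (p : ℕ) → (pp : Prime p) → (n : ℕ) → (H : Graph n) →
    IsTree H →
    ¬ (Σ (Fin n → Fin n) λ σ → IsAutomorphism H σ × HasOrder σ p) →
    ¬ IsStar H →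
    Σ (Fin n) λ α → Σ (Fin n) λ β →
    α ≢ β × NotOneMod (deg H α) p pp × NotOneMod (deg H β) p pp
lemma7 p pp n H (1≤n , connected , acyclic) no-automorphism not-star =
  fromInj₁ (λ (r , ≡1) → ⊥-elim (all-but-one-≡1 r ≡1)) (two-counterexamples⊎all-but-one (λ x → deg H x % p ≟ℕ 1 % p) 1≤n)
  where
  instance _ = prime⇒nonZero pp
  all-but-one-≡1 : ∀ r → (∀ x → x ≢ r → deg H x % p ≡ 1 % p) → ⊥
  all-but-one-≡1 r ≡1 with fringe⊎star H acyclic connected r
  ... | inj₂ star = not-star star
  ... | inj₁ F = no-automorphism (fringe⇒automorphismOfOrder H p F
    (m%n≡1%n⇒n<m (nonTrivial⇒n>1 p {{prime⇒nonTrivial pp}}) internal (≡1 vertex vertex≢r)))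
    where open Fringe F
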